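{- Let $n\ge1$ and let $T$ be a key with at most $n$ rows (entries arbitrary positive integers). Then $$\sum_{\substack{Q\ \mathrm{RSVT}:\ K_-(L(Q))\le T,\\ \max(Q)\le n}}\beta^{|\mathrm{wt}(Q)|-|T|}\,x^{\mathrm{wt}(Q)}=\mathfrak{L}^{(\beta)}_{\mathrm{wt}(\mathrm{cap}_n(T))},$$ where $|T|$ denotes the number of cells of $T$.
   Context: $\beta,x_1,\dots,x_n$ indeterminates. Tableaux in English convention; $T_c$ = set of entries of column $c$. A key is a tableau with strictly increasing columns and $T_1\supseteq T_2\supseteq\cdots$. For tableaux, $T\ge T'$ means same shape and entrywise $\ge$. $\mathrm{cap}_n$ acts on a key with at most $n$ rows: in each column replace the $k$ entries larger than $n$ by the $k$ largest elements of $[n]$ not in that column, then sort the column increasingly. For a tableau with entries in $[n]$ (resp. whose entries are subsets of $[n]$), $\mathrm{wt}$ is the weak composition whose $i$-th entry counts cells equal to (resp. containing) $i$; for a weak composition $\gamma$, $|\gamma|=\sum\gamma_i$, $x^\gamma=\prod x_i^{\gamma_i}$, and $\mathrm{key}(\gamma)$ is the key with column $c$ equal to $\{i:\gamma_i\ge c\}$. A reverse set-valued tableau (RSVT) fills cells with nonempty finite sets of positive integers with $\min Q(r,c)\ge\max Q(r,c+1)$ and $\min Q(r,c)>\max Q(r+1,c)$; $\max(Q)$ is the largest number appearing; $L(Q)$ keeps the largest element of each cell, giving a reverse semistandard tableau (RSSYT: rows weakly decreasing, columns strictly decreasing). For finite sets, $A\trianglerighteq B$ goes through $b\in B$ increasingly,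 each picking the smallest unpicked $a\in A$ with $a\ge b$; it is the set of picked elements. For an RSSYT $U$, $K_-(U)$ is the key whose column $i$ is $U_1\trianglerighteq(U_2\trianglerighteq(\cdots\trianglerighteq U_i))$. Lascoux polynomial: for a weak composition $\gamma$ of length $n$, $\mathfrak{L}^{(\beta)}_\gamma=\sum_Q\beta^{|\mathrm{wt}(Q)|-|\gamma|}x^{\mathrm{wt}(Q)}$, over RSVT $Q$ with entries subsets of $[n]$ and $K_-(L(Q))\le\mathrm{key}(\gamma)$. -}

module Defs where

open import Data.Nat using (ℕ; zero; suc; _+_; _∸_; _≤ᵇ_; _<ᵇ_; _≡ᵇ_; _⊔_; _⊓_)
open import Data.Bool using (Bool; true; false; _∧_; _∨_; not; if_then_else_)
open import Data.List using (List; []; _∷_; _++_; length; map; concatMap; reverse; foldr; take)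
open import Data.Nat.ListAction using (sum)
open import Data.Maybe using (Maybe; just; nothing)
open import Data.Product using (_×_; _,_)

filterB : {A : Set} → (A → Bool) → List A → List A
filterB p [] = []
filterB p (x ∷ xs) = if p x then x ∷ filterB p xs else filterB p xs

allB : {A : Set} → (A → Bool) → List A → Bool
allB p [] = true
allB p (x ∷ xs) = p x ∧ allB p xs

countB : {A : Set} → (A → Bool) → List A → ℕ
countB p xs = length (filterB p xs)

range : ℕ → List ℕ
range zero = []
range (suc n) = range n ++ (suc n ∷ [])

memB : ℕ → List ℕ → Bool
memB x [] = false
memB x (y ∷ ys) = (x ≡ᵇ y) ∨ memB x ys

insert : ℕ → List ℕ → List ℕ
insert x [] = x ∷ []
insert x (y ∷ ys) = if x ≤ᵇ y then x ∷ y ∷ ys else y ∷ insert x ys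

sort : List ℕ → List ℕ
sort [] = []
sort (x ∷ xs) = insert x (sort xs)

maxL : List ℕ → ℕ
maxL = foldr _⊔_ 0

minL : List ℕ → ℕ
minL [] = 0
minL (x ∷ xs) = foldr _⊓_ x xs

strictInc : List ℕ → Bool
strictInc [] = true
strictInc (x ∷ []) = true
strictInc (x ∷ y ∷ ys) = (x <ᵇ y) ∧ strictInc (y ∷ ys)

nonempty : {A : Set} → List A → Bool
nonempty [] = false
nonempty (_ ∷ _) = true

-- Tableaux (English convention), stored as the list of their columns,
-- each column listed from top to bottom.

Tab : Set → Set
Tab A = List (List A)

shape : {A : Set} → Tab A → List ℕ
shape = map length

weaklyDec : List ℕ → Bool
weaklyDec [] = true
weaklyDec (x ∷ []) = true
weaklyDec (x ∷ y ∷ ys) = (y ≤ᵇ x) ∧ weaklyDec (y ∷ ys)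

validShape : List ℕ → Bool
validShape sh = allB (λ l → 1 ≤ᵇ l) sh ∧ weaklyDec sh

cells : {A : Set} → Tab A → ℕ
cells T = sum (shape T)

nestedCols : Tab ℕ → Bool
nestedCols (a ∷ b ∷ rest) = allB (λ x → memB x a) b ∧ nestedCols (b ∷ rest)
nestedCols _ = true

isKey : Tab ℕ → Bool
isKey K = validShape (shape K)
        ∧ allB (λ col → strictInc col ∧ allB (λ x → 1 ≤ᵇ x) col) K
        ∧ nestedCols K

rowsAtMost : ℕ → Tab ℕ → Bool
rowsAtMost n K = allB (λ col → length col ≤ᵇ n) K

leqCol : List ℕ → List ℕ → Bool
leqCol [] [] = true
leqCol (a ∷ as) (b ∷ bs) = (a ≤ᵇ b) ∧ leqCol as bs
leqCol _ _ = false

leqTab : Tab ℕ → Tab ℕ → Bool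
leqTab [] [] = true
leqTab (a ∷ as) (b ∷ bs) = leqCol a b ∧ leqTab as bs
leqTab _ _ = false

capCol : ℕ → List ℕ → List ℕ
capCol n col = sort (keep ++ take k missing)
  where
  keep = filterB (λ x → x ≤ᵇ n) col
  k = length col ∸ length keep
  missing = filterB (λ i → not (memB i col)) (reverse (range n))

cap : ℕ → Tab ℕ → Tab ℕ
cap n K = map (capCol n) K

wtTab : ℕ → Tab ℕ → List ℕ
wtTab n K = map (λ i → sum (map (countB (λ x → x ≡ᵇ i)) K)) (range n)

-- key(γ): column c = { i : γ_i ≥ c }, for c = 1 .. max γ
keyCol : ℕ → ℕ → List ℕ → List ℕ
keyCol c i [] = []
keyCol c i (g ∷ gs) = if c ≤ᵇ g then i ∷ keyCol c (suc i) gs else keyCol c (suc i) gs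

keyOf : List ℕ → Tab ℕ
keyOf γ = map (λ c → keyCol c 1 γ) (range (maxL γ))

-- Reverse set-valued tableaux; cells are finite sets of positive integers,
-- stored as strictly increasing lists.

rowOK : Tab ℕ → Tab ℕ → Bool
rowOK (a ∷ as) (b ∷ bs) = (maxL b ≤ᵇ minL a) ∧ rowOK as bs
rowOK _ _ = true

adjOK : List (Tab ℕ) → Bool
adjOK (c ∷ c' ∷ cs) = rowOK c c' ∧ adjOK (c' ∷ cs)
adjOK _ = true

colOK : Tab ℕ → Bool
colOK (a ∷ b ∷ rest) = (maxL b <ᵇ minL a) ∧ colOK (b ∷ rest)
colOK _ = true

isRSVT : Tab (List ℕ) → Bool
isRSVT Q = validShape (shape Q)
         ∧ allB (allB (λ cell → nonempty cell ∧ strictInc cell ∧ allB (λ x → 1 ≤ᵇ x) cell)) Q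
         ∧ allB colOK Q
         ∧ adjOK Q

Lg : Tab (List ℕ) → Tab ℕ
Lg Q = map (map maxL) Q

wtRSVT : ℕ → Tab (List ℕ) → List ℕ
wtRSVT n Q = map (λ i → sum (map (countB (λ cell → memB i cell)) Q)) (range n)

pickGE : ℕ → List ℕ → Maybe (ℕ × List ℕ)
pickGE b [] = nothing
pickGE b (a ∷ as) with b ≤ᵇ a
... | true = just (a , as)
... | false with pickGE b as
...   | nothing = nothing
...   | just (a' , rest) = just (a' , a ∷ rest)

-- remaining (sorted) A, B sorted increasingly; returns the picked elements
triGo : List ℕ → List ℕ → List ℕ
triGo A [] = []
triGo A (b ∷ bs) with pickGE b A
... | nothing = triGo A bs
... | just (a , A') = a ∷ triGo A' bs

_⊵_ : List ℕ → List ℕ → List ℕ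
A ⊵ B = sort (triGo (sort A) (sort B))

nest : Tab ℕ → List ℕ
nest [] = []
nest (u ∷ []) = sort u
nest (u ∷ u' ∷ us) = u ⊵ nest (u' ∷ us)

Kminus : Tab ℕ → Tab ℕ
Kminus U = map (λ i → sort (nest (take i U))) (range (length U))

-- A polynomial in ℕ[β, x_1..x_n] is represented as the finite multiset
-- (list) of its monomials β^e x^α, each monomial being the pair (e , α);
-- two such sums are equal as polynomials iff the lists are permutations
-- of each other.

Monomial : Set
Monomial = ℕ × List ℕ

subsetsOf : List ℕ → List (List ℕ)
subsetsOf [] = [] ∷ []
subsetsOf (x ∷ xs) = subsetsOf xs ++ map (x ∷_) (subsetsOf xs)

nonemptySubsets : ℕ → List (List ℕ)
nonemptySubsets n = filterB nonempty (subsetsOf (range n))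

vecs : {A : Set} → ℕ → List A → List (List A)
vecs zero cs = [] ∷ []
vecs (suc k) cs = concatMap (λ c → map (c ∷_) (vecs k cs)) cs

fillings : {A : Set} → List ℕ → List A → List (Tab A)
fillings [] cs = [] ∷ []
fillings (l ∷ ls) cs = concatMap (λ col → map (col ∷_) (fillings ls cs)) (vecs l cs)

-- Σ_Q β^{|wt Q| - off} x^{wt Q}, over RSVT Q of shape sh with entries
-- subsets of [n] (i.e. max Q ≤ n) satisfying K_-(L(Q)) ≤ bound
rsvtSum : ℕ → List ℕ → Tab ℕ → ℕ → List Monomial
rsvtSum n sh bound off =
  map (λ Q → (sum (wtRSVT n Q) ∸ off , wtRSVT n Q))
      (filterB (λ Q → isRSVT Q ∧ leqTab (Kminus (Lg Q)) bound)
               (fillings sh (nonemptySubsets n)))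

lhsSum : ℕ → Tab ℕ → List Monomial
lhsSum n T = rsvtSum n (shape T) T (cells T)

lascoux : ℕ → List ℕ → List Monomial
lascoux n γ = rsvtSum n (shape (keyOf γ)) (keyOf γ) (sum γ)

-- The columns of K₋(L(Q)) are contained in the first column of L(Q), so for an RSVT Q with
-- entries in [n] they are strictly increasing with entries at most n. For such a column S and
-- a strictly increasing column C of length at most n, S ≤ C iff S ≤ cap_n(C): by induction,
-- using cap_{n+1}(C c) = cap_n(C) (n+1) whenever c > n+1. Hence the left-hand side is the same
-- sum with T replaced by cap_n(T). Finally cap_n(T) is a key of the same shape with entries in
-- [n], and a key K with entries in [n] satisfies key(wt K) = K and |wt K| = |K|.

module Submission where

open import Defs
open import Data.Nat using (ℕ; _≤_)
open import Data.Bool using (T)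
open import Data.List.Relation.Binary.Permutation.Propositional using (_↭_)

open import Data.Nat using (zero; suc; _+_; _∸_; _<_; _>_; _≤ᵇ_; _<ᵇ_; _≡ᵇ_; _⊔_; _⊓_; z≤n; s≤s; s≤s⁻¹)
open import Data.Nat.Properties
open import Algebra.Properties.CommutativeSemigroup +-commutativeSemigroup using (interchange)
open import Data.Nat.ListAction using (sum)
open import Data.Bool using (Bool; true; false; _∧_; _∨_; not; if_then_else_)
open import Data.Bool.Properties using (T-∧; T-≡; ∨-identityʳ; ∧-identityʳ; ∧-zeroʳ; ∧-assoc)
open import Data.List using (List; []; _∷_; _++_; _∷ʳ_; length; map; reverse; foldr; take; initLast; _∷ʳ′_)
open import Data.List.Properties using (++-identityʳ; ∷ʳ-++; reverse-++; length-++; map-cong)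
open import Data.List.Relation.Unary.All as All using (All; []; _∷_)
import Data.List.Relation.Unary.All.Properties as All
open import Data.List.Relation.Unary.AllPairs using (AllPairs; []; _∷_)
import Data.List.Relation.Unary.AllPairs as AllPairs
open import Data.List.Relation.Unary.Any using (here; there)
open import Data.List.Relation.Unary.Linked as Linked using (Linked; []; [-]; _∷_)
open import Data.List.Relation.Unary.Linked.Properties using (Linked⇒AllPairs)
open import Data.List.Relation.Unary.Unique.Propositional using (Unique)
open import Data.List.Membership.Propositional using (_∈_; _∉_; find)
open import Data.List.Membership.Propositional.Properties
  using (∈-++⁺ˡ; ∈-++⁺ʳ; ∈-++⁻; ∈-map⁺; ∈-map⁻; ∈-concatMap⁻)
open import Data.List.Membership.DecPropositional _≟_ using (_∈?_)
open import Data.List.Relation.Unary.AllPairs.Properties as AllPairs using ()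
open import Data.List.Relation.Unary.Unique.Propositional.Properties using (++⁺)
open import Data.List.Relation.Binary.Subset.Propositional using (_⊆_; _⊇_)
open import Data.List.Relation.Binary.Subset.Propositional.Properties using (⊆-reflexive-↭; All-resp-⊇; ∷⁺ʳ; ++⁺ˡ)
open import Data.List.Relation.Binary.Permutation.Propositional
  using (↭-refl; ↭-sym; ↭-trans; ↭-prep; ↭-swap; ↭-reflexive; ↭⇒↭ₛ)
open import Data.List.Relation.Binary.Permutation.Propositional.Properties
  using (All-resp-↭; ∈-resp-↭; ↭-reverse; shift; ++-comm)
open import Data.List.Relation.Binary.Permutation.Setoid.Properties as ↭ₛ using ()
open import Data.Maybe using (just; nothing)
open import Data.Product using (_×_; _,_; proj₁; proj₂; ∃; map₁)
open import Data.Sum using (inj₁; inj₂)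
open import Data.Unit using (tt)
open import Data.Empty using (⊥-elim)
open import Function using (_∘_; _⇔_; Equivalence; mk⇔; case_of_)
open import Relation.Binary.PropositionalEquality
  using (_≡_; _≢_; refl; sym; trans; cong; cong₂; subst; setoid; module ≡-Reasoning)
open import Relation.Nullary using (¬_; yes; no)

open Equivalence using (to; from)

T-∧⁻ : ∀ {a b} → T (a ∧ b) → T a × T b
T-∧⁻ = to T-∧

¬T⇒≡false : ∀ {b} → ¬ T b → b ≡ false
¬T⇒≡false {false} _ = refl
¬T⇒≡false {true} ¬t = ⊥-elim (¬t tt)

allB⇒All : ∀ {A : Set} {p : A → Bool} xs → T (allB p xs) → All (T ∘ p) xs
allB⇒All [] _ = []
allB⇒All (x ∷ xs) h = proj₁ (T-∧⁻ h) ∷ allB⇒All xs (proj₂ (T-∧⁻ h))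

memB⇒∈ : ∀ {x} xs → T (memB x xs) → x ∈ xs
memB⇒∈ {x} (y ∷ ys) h with x ≡ᵇ y in eq
... | true = here (≡ᵇ⇒≡ x y (from T-≡ eq))
... | false = there (memB⇒∈ ys h)

∈⇒memB : ∀ {x xs} → x ∈ xs → T (memB x xs)
∈⇒memB {x} (here refl) rewrite to T-≡ (≡⇒≡ᵇ x x refl) = tt
∈⇒memB {x} {y ∷ _} (there m) with x ≡ᵇ y
... | true = tt
... | false = ∈⇒memB m

module _ {A : Set} (p : A → Bool) where

  ∈-filterB⁻ : ∀ xs {z} → z ∈ filterB p xs → z ∈ xs × T (p z)
  ∈-filterB⁻ (x ∷ xs) m with p x in eq
  ∈-filterB⁻ (x ∷ xs) (here refl) | true = here refl , from T-≡ eq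
  ∈-filterB⁻ (x ∷ xs) (there m) | true = map₁ there (∈-filterB⁻ xs m)
  ... | false = map₁ there (∈-filterB⁻ xs m)

  ∈-filterB⁺ : ∀ {xs z} → z ∈ xs → T (p z) → z ∈ filterB p xs
  ∈-filterB⁺ {x ∷ xs} m pz with p x in eq
  ∈-filterB⁺ {x ∷ xs} (here refl) pz | true = here refl
  ∈-filterB⁺ {x ∷ xs} (there m) pz | true = there (∈-filterB⁺ m pz)
  ∈-filterB⁺ {x ∷ xs} (here refl) pz | false = ⊥-elim (subst T eq pz)
  ∈-filterB⁺ {x ∷ xs} (there m) pz | false = ∈-filterB⁺ m pz

  filterB-accept : ∀ {x} xs → T (p x) → filterB p (x ∷ xs) ≡ x ∷ filterB p xs
  filterB-accept {x} xs px rewrite to T-≡ px = refl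

  filterB-reject : ∀ {x} xs → ¬ T (p x) → filterB p (x ∷ xs) ≡ filterB p xs
  filterB-reject {x} xs ¬px rewrite ¬T⇒≡false ¬px = refl

  filterB-all : ∀ {xs} → All (T ∘ p) xs → filterB p xs ≡ xs
  filterB-all [] = refl
  filterB-all {x ∷ xs} (px ∷ pxs) = trans (filterB-accept xs px) (cong (x ∷_) (filterB-all pxs))

  filterB-none : ∀ {xs} → All (¬_ ∘ T ∘ p) xs → filterB p xs ≡ []
  filterB-none [] = refl
  filterB-none {x ∷ xs} (¬px ∷ ¬pxs) = trans (filterB-reject xs ¬px) (filterB-none ¬pxs)

  filterB-++ : ∀ xs ys → filterB p (xs ++ ys) ≡ filterB p xs ++ filterB p ys
  filterB-++ [] ys = refl
  filterB-++ (x ∷ xs) ys with p x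
  ... | true = cong (x ∷_) (filterB-++ xs ys)
  ... | false = filterB-++ xs ys

  length-filterB≤ : ∀ xs → length (filterB p xs) ≤ length xs
  length-filterB≤ [] = z≤n
  length-filterB≤ (x ∷ xs) with p x
  ... | true = s≤s (length-filterB≤ xs)
  ... | false = m≤n⇒m≤1+n (length-filterB≤ xs)

  filterB-AllPairs : ∀ {R : A → A → Set} {xs} → AllPairs R xs → AllPairs R (filterB p xs)
  filterB-AllPairs [] = []
  filterB-AllPairs {xs = x ∷ xs} (Rx ∷ Rxs) with p x
  ... | true = All.tabulate (All.lookup Rx ∘ proj₁ ∘ ∈-filterB⁻ xs) ∷ filterB-AllPairs Rxs
  ... | false = filterB-AllPairs Rxs

  countB-∷ : ∀ x xs → countB p (x ∷ xs) ≡ countB p (x ∷ []) + countB p xs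
  countB-∷ x xs with p x
  ... | true = refl
  ... | false = refl

filterB-cong : ∀ {A : Set} {p q : A → Bool} xs → (∀ {x} → x ∈ xs → p x ≡ q x) → filterB p xs ≡ filterB q xs
filterB-cong [] _ = refl
filterB-cong {p = p} {q} (x ∷ xs) eq with p x | q x | eq (here refl)
... | true | true | _ = cong (x ∷_) (filterB-cong xs (eq ∘ there))
... | false | false | _ = filterB-cong xs (eq ∘ there)

length-∷ʳ : ∀ {A : Set} (xs : List A) x → length (xs ∷ʳ x) ≡ suc (length xs)
length-∷ʳ xs x = trans (length-++ xs) (+-comm (length xs) 1)

take-⊆ : ∀ k (xs : List ℕ) → take k xs ⊆ xs
take-⊆ (suc k) (x ∷ xs) (here refl) = here refl
take-⊆ (suc k) (x ∷ xs) (there m) = there (take-⊆ k xs m)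

Ascending : List ℕ → Set
Ascending = AllPairs _<_

Ascending⇒Unique : ∀ {xs} → Ascending xs → Unique xs
Ascending⇒Unique = AllPairs.map <⇒≢

unique-resp-↭ : ∀ {xs ys : List ℕ} → xs ↭ ys → Unique xs → Unique ys
unique-resp-↭ p = ↭ₛ.Unique-resp-↭ (setoid ℕ) (↭⇒↭ₛ p)

strictInc⇒Ascending : ∀ xs → T (strictInc xs) → Ascending xs
strictInc⇒Ascending xs h = Linked⇒AllPairs <-trans (linked xs h)
  where
  linked : ∀ xs → T (strictInc xs) → Linked _<_ xs
  linked [] _ = []
  linked (x ∷ []) _ = [-]
  linked (x ∷ y ∷ ys) h = <ᵇ⇒< x y (proj₁ (T-∧⁻ h)) ∷ linked (y ∷ ys) (proj₂ (T-∧⁻ h))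

ascending-∷ʳ⁻ : ∀ xs {y} → Ascending (xs ∷ʳ y) → Ascending xs × All (_< y) xs
ascending-∷ʳ⁻ [] _ = [] , []
ascending-∷ʳ⁻ (x ∷ xs) (x< ∷ asc) with ascending-∷ʳ⁻ xs asc
... | asc′ , <y = (All.tabulate (All.lookup x< ∘ ∈-++⁺ˡ) ∷ asc′) , (All.lookup x< (∈-++⁺ʳ xs (here refl)) ∷ <y)

ascending-∷ʳ⁺ : ∀ {xs y} → Ascending xs → All (_< y) xs → Ascending (xs ∷ʳ y)
ascending-∷ʳ⁺ [] [] = [] ∷ []
ascending-∷ʳ⁺ (x< ∷ asc) (x<y ∷ <y) = All.++⁺ x< (x<y ∷ []) ∷ ascending-∷ʳ⁺ asc <y

ascending-⊆-antisym : ∀ {xs ys} → Ascending xs → Ascending ys → xs ⊆ ys → ys ⊆ xs → xs ≡ ys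
ascending-⊆-antisym {[]} {[]} _ _ _ _ = refl
ascending-⊆-antisym {[]} {y ∷ _} _ _ _ ys⊆ with () ← ys⊆ (here refl)
ascending-⊆-antisym {x ∷ _} {[]} _ _ xs⊆ _ with () ← xs⊆ (here refl)
ascending-⊆-antisym {x ∷ xs} {y ∷ ys} (x< ∷ xs↑) (y< ∷ ys↑) xs⊆ ys⊆ =
  cong₂ _∷_ x≡y (ascending-⊆-antisym xs↑ ys↑ (tail⊆ x≡y x< xs⊆) (tail⊆ (sym x≡y) y< ys⊆))
  where
  head≤ : ∀ {u us v} → All (u <_) us → v ∈ u ∷ us → u ≤ v
  head≤ _ (here refl) = ≤-refl
  head≤ u< (there m) = <⇒≤ (All.lookup u< m)
  x≡y : x ≡ y
  x≡y = ≤-antisym (head≤ x< (ys⊆ (here refl))) (head≤ y< (xs⊆ (here refl)))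
  tail⊆ : ∀ {u v us vs} → u ≡ v → All (u <_) us → u ∷ us ⊆ v ∷ vs → us ⊆ vs
  tail⊆ refl u< ⊆ m with ⊆ (there m)
  ... | here refl = ⊥-elim (<-irrefl refl (All.lookup u< m))
  ... | there m′ = m′

insert-↭ : ∀ x xs → insert x xs ↭ x ∷ xs
insert-↭ x [] = ↭-refl
insert-↭ x (y ∷ ys) with x ≤ᵇ y
... | true = ↭-refl
... | false = ↭-trans (↭-prep y (insert-↭ x ys)) (↭-swap y x ↭-refl)

sort-↭ : ∀ xs → sort xs ↭ xs
sort-↭ [] = ↭-refl
sort-↭ (x ∷ xs) = ↭-trans (insert-↭ x (sort xs)) (↭-prep x (sort-↭ xs))

sort-⊆ : ∀ xs → sort xs ⊆ xs
sort-⊆ xs = ⊆-reflexive-↭ (sort-↭ xs)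

⊆-sort : ∀ xs → xs ⊆ sort xs
⊆-sort xs = ⊆-reflexive-↭ (↭-sym (sort-↭ xs))

insert-ascending : ∀ x {xs} → Ascending xs → x ∉ xs → Ascending (insert x xs)
insert-ascending x [] _ = [] ∷ []
insert-ascending x {y ∷ ys} (y< ∷ ys↑) x∉ with x ≤ᵇ y in eq
... | true = (x<y ∷ All.map (<-trans x<y) y<) ∷ y< ∷ ys↑
  where x<y = ≤∧≢⇒< (≤ᵇ⇒≤ x y (from T-≡ eq)) (x∉ ∘ here)
... | false = All-resp-↭ (↭-sym (insert-↭ x ys)) (y<x ∷ y<) ∷ insert-ascending x ys↑ (x∉ ∘ there)
  where y<x = ≰⇒> (λ x≤y → subst T eq (≤⇒≤ᵇ x≤y))

sort-ascending : ∀ {xs} → Unique xs → Ascending (sort xs)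
sort-ascending {[]} [] = []
sort-ascending {x ∷ xs} (x≢ ∷ u) = insert-ascending x (sort-ascending u) (λ m → All.lookup x≢ (sort-⊆ xs m) refl)

sort-unique : ∀ {xs} → Unique xs → Unique (sort xs)
sort-unique = Ascending⇒Unique ∘ sort-ascending

sort-id : ∀ {xs} → Ascending xs → sort xs ≡ xs
sort-id {xs} asc = ascending-⊆-antisym (sort-ascending (Ascending⇒Unique asc)) asc (sort-⊆ xs) (⊆-sort xs)

sort-cong-↭ : ∀ {xs ys} → Unique xs → xs ↭ ys → sort xs ≡ sort ys
sort-cong-↭ {xs} {ys} u p = ascending-⊆-antisym (sort-ascending u) (sort-ascending (unique-resp-↭ p u))
  (⊆-sort ys ∘ ∈-resp-↭ p ∘ sort-⊆ xs) (⊆-sort xs ∘ ∈-resp-↭ (↭-sym p) ∘ sort-⊆ ys)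

insert-∷ʳ : ∀ {x y} xs → x ≤ y → insert x (xs ∷ʳ y) ≡ insert x xs ∷ʳ y
insert-∷ʳ {x} {y} [] x≤y rewrite to T-≡ (≤⇒≤ᵇ x≤y) = refl
insert-∷ʳ {x} (z ∷ zs) x≤y with x ≤ᵇ z
... | true = refl
... | false = cong (z ∷_) (insert-∷ʳ zs x≤y)

sort-∷ʳ : ∀ {y} xs → All (_≤ y) xs → sort (xs ∷ʳ y) ≡ sort xs ∷ʳ y
sort-∷ʳ [] [] = refl
sort-∷ʳ (x ∷ xs) (x≤y ∷ ≤y) = trans (cong (insert x) (sort-∷ʳ xs ≤y)) (insert-∷ʳ (sort xs) x≤y)

pickGE-↭ : ∀ b A {a A′} → pickGE b A ≡ just (a , A′) → A ↭ a ∷ A′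
pickGE-↭ b (c ∷ cs) eq with b ≤ᵇ c
pickGE-↭ b (c ∷ cs) refl | true = ↭-refl
... | false with pickGE b cs in eq′
pickGE-↭ b (c ∷ cs) refl | false | just (a , rest) =
  ↭-trans (↭-prep c (pickGE-↭ b cs eq′)) (↭-swap c a ↭-refl)

triGo-⊆ : ∀ A B → triGo A B ⊆ A
triGo-⊆ A (b ∷ bs) m with pickGE b A in eq
... | nothing = triGo-⊆ A bs m
... | just (a , A′) = ⊆-reflexive-↭ (↭-sym (pickGE-↭ b A eq)) (∷⁺ʳ a (triGo-⊆ A′ bs) m)

triGo-unique : ∀ {A} B → Unique A → Unique (triGo A B)
triGo-unique [] _ = []
triGo-unique {A} (b ∷ bs) u with pickGE b A in eq
... | nothing = triGo-unique bs u
... | just (a , A′) with unique-resp-↭ (pickGE-↭ b A eq) u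
...   | a≢ ∷ u′ = All-resp-⊇ (triGo-⊆ A′ bs) a≢ ∷ triGo-unique bs u′

nest-⊆ : ∀ u us → nest (u ∷ us) ⊆ u
nest-⊆ u [] = sort-⊆ u
nest-⊆ u (u′ ∷ us) = sort-⊆ u ∘ triGo-⊆ (sort u) (sort N) ∘ sort-⊆ (triGo (sort u) (sort N))
  where N = nest (u′ ∷ us)

nest-unique : ∀ {u} us → Unique u → Unique (nest (u ∷ us))
nest-unique [] u = sort-unique u
nest-unique (u′ ∷ us) u = sort-unique (triGo-unique (sort (nest (u′ ∷ us))) (sort-unique u))

Kminus-⊆-head : ∀ {u} us → Unique u → All (λ S → Ascending S × S ⊆ u) (Kminus (u ∷ us))
Kminus-⊆-head {u} us uniq = All.map⁺ (All.tabulate (λ {i} _ → column i))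
  where
  column : ∀ i → Ascending (sort (nest (take i (u ∷ us)))) × sort (nest (take i (u ∷ us))) ⊆ u
  column zero = [] , λ ()
  column (suc i) = sort-ascending (nest-unique (take i us) uniq) , nest-⊆ u (take i us) ∘ sort-⊆ _

countFrom : ℕ → ℕ → List ℕ
countFrom s zero = []
countFrom s (suc k) = s ∷ countFrom (suc s) k

countFrom-∷ʳ : ∀ s k → countFrom s (suc k) ≡ countFrom s k ∷ʳ (s + k)
countFrom-∷ʳ s zero = cong (_∷ []) (sym (+-identityʳ s))
countFrom-∷ʳ s (suc k) = cong (s ∷_) (trans (countFrom-∷ʳ (suc s) k) (cong (countFrom (suc s) k ∷ʳ_) (sym (+-suc s k))))

range≡countFrom : ∀ n → range n ≡ countFrom 1 n
range≡countFrom zero = refl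
range≡countFrom (suc n) = trans (cong (_∷ʳ suc n) (range≡countFrom n)) (sym (countFrom-∷ʳ 1 n))

∈-countFrom⁻ : ∀ s k {z} → z ∈ countFrom s k → s ≤ z × z < s + k
∈-countFrom⁻ s (suc k) (here refl) = ≤-refl , m<m+n s (s≤s z≤n)
∈-countFrom⁻ s (suc k) {z} (there m) with ∈-countFrom⁻ (suc s) k m
... | s<z , z< = <⇒≤ s<z , subst (z <_) (sym (+-suc s k)) z<

∈-countFrom⁺ : ∀ s k {z} → s ≤ z → z < s + k → z ∈ countFrom s k
∈-countFrom⁺ s zero s≤z z< = ⊥-elim (<⇒≱ (subst (_ <_) (+-identityʳ s) z<) s≤z)
∈-countFrom⁺ s (suc k) {z} s≤z z< with z ≟ s
... | yes refl = here refl
... | no z≢s = there (∈-countFrom⁺ (suc s) k (≤∧≢⇒< s≤z (z≢s ∘ sym)) (subst (z <_) (+-suc s k) z<))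

countFrom-ascending : ∀ s k → Ascending (countFrom s k)
countFrom-ascending s zero = []
countFrom-ascending s (suc k) = All.tabulate (proj₁ ∘ ∈-countFrom⁻ (suc s) k) ∷ countFrom-ascending (suc s) k

∈-range⁻ : ∀ n {z} → z ∈ range n → 1 ≤ z × z ≤ n
∈-range⁻ n m with ∈-countFrom⁻ 1 n (subst (_ ∈_) (range≡countFrom n) m)
... | 1≤z , z<1+n = 1≤z , s≤s⁻¹ z<1+n

∈-range⁺ : ∀ n {z} → 1 ≤ z → z ≤ n → z ∈ range n
∈-range⁺ n 1≤z z≤ = subst (_ ∈_) (sym (range≡countFrom n)) (∈-countFrom⁺ 1 n 1≤z (s≤s z≤))

range-unique : ∀ n → Unique (range n)
range-unique n = subst Unique (sym (range≡countFrom n)) (Ascending⇒Unique (countFrom-ascending 1 n))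

reverse-range-suc : ∀ n → reverse (range (suc n)) ≡ suc n ∷ reverse (range n)
reverse-range-suc n = reverse-++ (range n) (suc n ∷ [])

kept : ℕ → List ℕ → List ℕ
kept n C = filterB (_≤ᵇ n) C

missing : ℕ → List ℕ → List ℕ
missing n C = filterB (λ i → not (memB i C)) (reverse (range n))

-- capCol n C unfolds to sort (capList n C).
capList : ℕ → List ℕ → List ℕ
capList n C = kept n C ++ take (length C ∸ length (kept n C)) (missing n C)

kept-≤ : ∀ n C → All (_≤ n) (kept n C)
kept-≤ n C = All.tabulate (≤ᵇ⇒≤ _ n ∘ proj₂ ∘ ∈-filterB⁻ _ C)

∈-missing⁻ : ∀ n C {z} → z ∈ missing n C → z ∉ C × (1 ≤ z × z ≤ n)
∈-missing⁻ n C m with ∈-filterB⁻ _ (reverse (range n)) m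
... | z∈ , z∉ = (λ z∈C → subst T (cong not (to T-≡ (∈⇒memB z∈C))) z∉)
              , ∈-range⁻ n (∈-resp-↭ (↭-reverse (range n)) z∈)

capList-unique : ∀ n {C} → Unique C → Unique (capList n C)
capList-unique n {C} u = ++⁺ (filterB-AllPairs _ u)
  (AllPairs.take⁺ _ (filterB-AllPairs _ (unique-resp-↭ (↭-sym (↭-reverse (range n))) (range-unique n))))
  (λ (k , m) → proj₁ (∈-missing⁻ n C (take-⊆ _ _ m)) (proj₁ (∈-filterB⁻ _ C k)))

capList-≤ : ∀ n C → All (_≤ n) (capList n C)
capList-≤ n C = All.++⁺ (kept-≤ n C) (All.take⁺ _ (All.tabulate (proj₂ ∘ proj₂ ∘ ∈-missing⁻ n C)))

capList-positive : ∀ n {C} → All (1 ≤_) C → All (1 ≤_) (capList n C)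
capList-positive n {C} pos = All.++⁺ (All.tabulate (All.lookup pos ∘ proj₁ ∘ ∈-filterB⁻ _ C))
                                     (All.take⁺ _ (All.tabulate (proj₁ ∘ proj₂ ∘ ∈-missing⁻ n C)))

capCol-ascending : ∀ n {C} → Unique C → Ascending (capCol n C)
capCol-ascending n = sort-ascending ∘ capList-unique n

capCol-≤ : ∀ n C → All (_≤ n) (capCol n C)
capCol-≤ n C = All-resp-⊇ (sort-⊆ (capList n C)) (capList-≤ n C)

capCol-positive : ∀ n {C} → All (1 ≤_) C → All (1 ≤_) (capCol n C)
capCol-positive n {C} = All-resp-⊇ (sort-⊆ (capList n C)) ∘ capList-positive n

∈-capCol⁺ : ∀ {n C z} → z ∈ C → z ≤ n → z ∈ capCol n C
∈-capCol⁺ {n} {C} z∈C z≤ = ⊆-sort (capList n C) (∈-++⁺ˡ (∈-filterB⁺ _ z∈C (≤⇒≤ᵇ z≤)))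

capCol-within : ∀ {n C} → Ascending C → All (_≤ n) C → capCol n C ≡ C
capCol-within {n} {C} asc ≤n
  rewrite filterB-all (_≤ᵇ n) (All.map ≤⇒≤ᵇ ≤n) | n∸n≡0 (length C) | ++-identityʳ C = sort-id asc

kept-none : ∀ {n xs} → All (n <_) xs → kept n xs ≡ []
kept-none {n} = filterB-none (_≤ᵇ n) ∘ All.map (λ n<x → <⇒≱ n<x ∘ ≤ᵇ⇒≤ _ n)

kept-∷ʳ : ∀ {n c} C → n < c → kept n (C ∷ʳ c) ≡ kept n C
kept-∷ʳ {n} {c} C n<c = begin
  kept n (C ++ c ∷ [])              ≡⟨ filterB-++ _ C (c ∷ []) ⟩
  kept n C ++ kept n (c ∷ [])        ≡⟨ cong (kept n C ++_) (kept-none (n<c ∷ [])) ⟩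
  kept n C ++ []                     ≡⟨ ++-identityʳ _ ⟩
  kept n C ∎
  where open ≡-Reasoning

≤ᵇ-suc : ∀ {x n} → x ≢ suc n → (x ≤ᵇ suc n) ≡ (x ≤ᵇ n)
≤ᵇ-suc {x} {n} x≢ with x ≤? n
... | yes x≤n = trans (to T-≡ (≤⇒≤ᵇ (m≤n⇒m≤1+n x≤n))) (sym (to T-≡ (≤⇒≤ᵇ x≤n)))
... | no x≰n = trans (¬T⇒≡false (λ t → x≰n (s≤s⁻¹ (≤∧≢⇒< (≤ᵇ⇒≤ x (suc n) t) x≢))))
                     (sym (¬T⇒≡false (x≰n ∘ ≤ᵇ⇒≤ x n)))

kept-suc-∉ : ∀ {n C} → suc n ∉ C → kept (suc n) C ≡ kept n C
kept-suc-∉ {n} {C} ∉C = filterB-cong {p = _≤ᵇ suc n} {q = _≤ᵇ n} C (λ {x} m → ≤ᵇ-suc {x} (λ { refl → ∉C m }))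

kept-suc-∈ : ∀ {n C} → Ascending C → suc n ∈ C → kept (suc n) C ≡ kept n C ∷ʳ suc n
kept-suc-∈ {n} {x ∷ xs} (x< ∷ _) (here refl) = begin
  kept (suc n) (suc n ∷ xs)    ≡⟨ filterB-accept (_≤ᵇ suc n) xs (≤⇒≤ᵇ (≤-refl {suc n})) ⟩
  suc n ∷ kept (suc n) xs      ≡⟨ cong (suc n ∷_) (kept-none x<) ⟩
  suc n ∷ []                   ≡⟨ cong (_∷ʳ suc n) (kept-none (All.map <⇒≤ x<)) ⟨
  kept n xs ∷ʳ suc n           ≡⟨ cong (_∷ʳ suc n) (filterB-reject (_≤ᵇ n) xs (1+n≰n ∘ ≤ᵇ⇒≤ (suc n) n)) ⟨
  kept n (suc n ∷ xs) ∷ʳ suc n ∎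
  where open ≡-Reasoning
kept-suc-∈ {n} {x ∷ xs} (x< ∷ xs↑) (there m) = begin
  kept (suc n) (x ∷ xs)      ≡⟨ filterB-accept (_≤ᵇ suc n) xs (≤⇒≤ᵇ (<⇒≤ x<1+n)) ⟩
  x ∷ kept (suc n) xs        ≡⟨ cong (x ∷_) (kept-suc-∈ xs↑ m) ⟩
  x ∷ kept n xs ∷ʳ suc n     ≡⟨ cong (_∷ʳ suc n) (filterB-accept (_≤ᵇ n) xs (≤⇒≤ᵇ (s≤s⁻¹ x<1+n))) ⟨
  kept n (x ∷ xs) ∷ʳ suc n ∎
  where
  open ≡-Reasoning
  x<1+n = All.lookup x< m

memB-∷ʳ : ∀ {i c} C → i < c → memB i (C ∷ʳ c) ≡ memB i C
memB-∷ʳ {i} {c} [] i<c = trans (∨-identityʳ _) (¬T⇒≡false (<⇒≢ i<c ∘ ≡ᵇ⇒≡ i c))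
memB-∷ʳ {i} (x ∷ C) i<c = cong ((i ≡ᵇ x) ∨_) (memB-∷ʳ C i<c)

missing-∷ʳ : ∀ {n c} C → n < c → missing n (C ∷ʳ c) ≡ missing n C
missing-∷ʳ {n} C n<c = filterB-cong (reverse (range n))
  (λ m → cong not (memB-∷ʳ C (≤-<-trans (proj₂ (∈-range⁻ n (∈-resp-↭ (↭-reverse (range n)) m))) n<c)))

missing-suc : ∀ n C → missing (suc n) C ≡ (if not (memB (suc n) C) then suc n ∷ missing n C else missing n C)
missing-suc n C = cong (filterB (λ i → not (memB i C))) (reverse-range-suc n)

-- If suc n ∈ C it is kept at level suc n but not at level n; otherwise it is the largest missing
-- value at level suc n. Either way the result is capList n C with suc n inserted.
capList-∷ʳ : ∀ {n C c} → Ascending C → suc n < c →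
  capList (suc n) (C ∷ʳ c) ≡ kept n C ++ suc n ∷ take (length C ∸ length (kept n C)) (missing n C)
capList-∷ʳ {n} {C} {c} asc lt
  rewrite kept-∷ʳ C lt | missing-∷ʳ {suc n} C lt | missing-suc n C | length-∷ʳ C c with memB (suc n) C in eq
... | false rewrite kept-suc-∉ {n} {C} (λ m → subst T eq (∈⇒memB m))
                  | +-∸-assoc 1 (length-filterB≤ (_≤ᵇ n) C) = refl
... | true rewrite kept-suc-∈ asc (memB⇒∈ C (from T-≡ eq))
                 | length-∷ʳ (kept n C) (suc n) = ∷ʳ-++ (kept n C) (suc n) _

capCol-∷ʳ : ∀ {n C c} → Ascending (C ∷ʳ c) → suc n < c → capCol (suc n) (C ∷ʳ c) ≡ capCol n C ∷ʳ suc n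
capCol-∷ʳ {n} {C} {c} asc lt = begin
  sort (capList (suc n) (C ∷ʳ c))  ≡⟨ cong sort (capList-∷ʳ (proj₁ (ascending-∷ʳ⁻ C asc)) lt) ⟩
  sort (keep ++ suc n ∷ rest)      ≡⟨ sort-cong-↭ uniq move-to-end ⟩
  sort ((keep ++ rest) ∷ʳ suc n)   ≡⟨ sort-∷ʳ (capList n C) (All.map m≤n⇒m≤1+n (capList-≤ n C)) ⟩
  capCol n C ∷ʳ suc n ∎
  where
  open ≡-Reasoning
  keep = kept n C
  rest = take (length C ∸ length keep) (missing n C)
  move-to-end : keep ++ suc n ∷ rest ↭ (keep ++ rest) ∷ʳ suc n
  move-to-end = ↭-trans (shift (suc n) keep rest) (++-comm (suc n ∷ []) (keep ++ rest))
  uniq : Unique (keep ++ suc n ∷ rest)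
  uniq = subst Unique (capList-∷ʳ (proj₁ (ascending-∷ʳ⁻ C asc)) lt) (capList-unique (suc n) (Ascending⇒Unique asc))

-- An ascending column, taken apart by removing its last entry and lowering n while that entry exceeds n.
data CapView : ℕ → List ℕ → Set where
  within : ∀ {n C} → Ascending C → All (_≤ n) C → CapView n C
  beyond : ∀ {n C c} → suc n < c → All (_< c) C → CapView n C → CapView (suc n) (C ∷ʳ c)

capView-ascending : ∀ {n C} → CapView n C → Ascending C
capView-ascending (within asc _) = asc
capView-ascending (beyond _ <c v) = ascending-∷ʳ⁺ (capView-ascending v) <c

capView : ∀ n {C} → Ascending C → length C ≤ n → CapView n C
capView n {C} asc len with initLast C
... | [] = within [] []
... | C′ ∷ʳ′ c with ascending-∷ʳ⁻ C′ asc | c ≤? n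
...   | _ , <c | yes c≤n = within asc (All.++⁺ (All.map (λ z<c → ≤-trans (<⇒≤ z<c) c≤n) <c) (c≤n ∷ []))
capView zero asc len | C′ ∷ʳ′ c | _ | no _ with () ← subst (_≤ 0) (length-∷ʳ C′ c) len
capView (suc n) asc len | C′ ∷ʳ′ c | asc′ , <c | no c≰ =
  beyond (≰⇒> c≰) <c (capView n asc′ (s≤s⁻¹ (subst (_≤ suc n) (length-∷ʳ C′ c) len)))

length-capCol : ∀ {n C} → CapView n C → length (capCol n C) ≡ length C
length-capCol (within asc ≤n) = cong length (capCol-within asc ≤n)
length-capCol v@(beyond {n} {C} {c} lt _ v′) = begin
  length (capCol (suc n) (C ∷ʳ c))  ≡⟨ cong length (capCol-∷ʳ (capView-ascending v) lt) ⟩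
  length (capCol n C ∷ʳ suc n)      ≡⟨ length-∷ʳ (capCol n C) (suc n) ⟩
  suc (length (capCol n C))         ≡⟨ cong suc (length-capCol v′) ⟩
  suc (length C)                    ≡⟨ length-∷ʳ C c ⟨
  length (C ∷ʳ c) ∎
  where open ≡-Reasoning

leqCol-[]-∷ʳ : ∀ xs y → leqCol [] (xs ∷ʳ y) ≡ false
leqCol-[]-∷ʳ [] y = refl
leqCol-[]-∷ʳ (_ ∷ _) y = refl

leqCol-∷ʳ-[] : ∀ xs y → leqCol (xs ∷ʳ y) [] ≡ false
leqCol-∷ʳ-[] [] y = refl
leqCol-∷ʳ-[] (_ ∷ _) y = refl

leqCol-∷ʳ : ∀ xs ys x y → leqCol (xs ∷ʳ x) (ys ∷ʳ y) ≡ leqCol xs ys ∧ (x ≤ᵇ y)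
leqCol-∷ʳ [] [] x y = ∧-identityʳ (x ≤ᵇ y)
leqCol-∷ʳ [] (b ∷ bs) x y rewrite leqCol-[]-∷ʳ bs y = ∧-zeroʳ (x ≤ᵇ b)
leqCol-∷ʳ (a ∷ as) [] x y rewrite leqCol-∷ʳ-[] as x = ∧-zeroʳ (a ≤ᵇ y)
leqCol-∷ʳ (a ∷ as) (b ∷ bs) x y rewrite leqCol-∷ʳ as bs x y = sym (∧-assoc (a ≤ᵇ b) _ _)

≤-last : ∀ {C c z} → All (_< c) C → z ∈ C ∷ʳ c → z ≤ c
≤-last {C} <c m with ∈-++⁻ C m
... | inj₁ z∈C = <⇒≤ (All.lookup <c z∈C)
... | inj₂ (here refl) = ≤-refl

leqCol-capCol : ∀ {n S C} → Ascending S → All (_≤ n) S → CapView n C → leqCol S (capCol n C) ≡ leqCol S C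
leqCol-capCol {S = S} _ _ (within asc ≤n) = cong (leqCol S) (capCol-within asc ≤n)
leqCol-capCol {S = S} S↑ S≤ v@(beyond {n} {C} {c} lt _ v′) rewrite capCol-∷ʳ (capView-ascending v) lt with initLast S
... | [] = trans (leqCol-[]-∷ʳ (capCol n C) (suc n)) (sym (leqCol-[]-∷ʳ C c))
... | S′ ∷ʳ′ x with ascending-∷ʳ⁻ S′ S↑
...   | S′↑ , <x = begin
  leqCol (S′ ∷ʳ x) (capCol n C ∷ʳ suc n)  ≡⟨ leqCol-∷ʳ S′ (capCol n C) x (suc n) ⟩
  leqCol S′ (capCol n C) ∧ (x ≤ᵇ suc n)   ≡⟨ cong₂ _∧_ (leqCol-capCol S′↑ S′≤ v′) x≤ᵇ ⟩
  leqCol S′ C ∧ (x ≤ᵇ c)                  ≡⟨ leqCol-∷ʳ S′ C x c ⟨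
  leqCol (S′ ∷ʳ x) (C ∷ʳ c) ∎
  where
  open ≡-Reasoning
  x≤1+n = All.lookup S≤ (∈-++⁺ʳ S′ (here refl))
  S′≤ = All.map (λ y<x → s≤s⁻¹ (≤-trans y<x x≤1+n)) <x
  x≤ᵇ = trans (to T-≡ (≤⇒≤ᵇ x≤1+n)) (sym (to T-≡ (≤⇒≤ᵇ (≤-trans x≤1+n (<⇒≤ lt)))))

capCol-mono : ∀ {n C D} → CapView n C → Ascending D → D ⊆ C → capCol n D ⊆ capCol n C
capCol-mono (within C↑ C≤) D↑ D⊆ rewrite capCol-within C↑ C≤ | capCol-within D↑ (All-resp-⊇ D⊆ C≤) = D⊆
capCol-mono {D = D} v@(beyond {n} {C} {c} lt <c v′) D↑ D⊆ rewrite capCol-∷ʳ (capView-ascending v) lt with initLast D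
... | [] = λ ()
... | D′ ∷ʳ′ d with ascending-∷ʳ⁻ D′ D↑ | d ≤? suc n
...   | _ | yes d≤ = subst (_⊆ capCol n C ∷ʳ suc n) (sym (capCol-within D↑ D≤)) kept-or-top
  where
  D≤ = All.tabulate (λ m → ≤-trans (≤-last (proj₂ (ascending-∷ʳ⁻ D′ D↑)) m) d≤)
  kept-or-top : D′ ∷ʳ d ⊆ capCol n C ∷ʳ suc n
  kept-or-top {z} m with z ≟ suc n | ∈-++⁻ C (D⊆ m)
  ... | yes refl | _ = ∈-++⁺ʳ _ (here refl)
  ... | no z≢ | inj₁ z∈C = ∈-++⁺ˡ (∈-capCol⁺ z∈C (s≤s⁻¹ (≤∧≢⇒< (All.lookup D≤ m) z≢)))
  ... | no _ | inj₂ (here refl) = ⊥-elim (<⇒≱ lt (All.lookup D≤ m))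
...   | D′↑ , <d | no d≰ = subst (_⊆ capCol n C ∷ʳ suc n) (sym (capCol-∷ʳ D↑ (≰⇒> d≰)))
                                  (++⁺ˡ (suc n ∷ []) (capCol-mono v′ D′↑ D′⊆C))
  where
  D′⊆C : D′ ⊆ C
  D′⊆C {y} m with ∈-++⁻ C (D⊆ (∈-++⁺ˡ m))
  ... | inj₁ y∈C = y∈C
  ... | inj₂ (here refl) = ⊥-elim (<⇒≱ (All.lookup <d m) (≤-last <c (D⊆ (∈-++⁺ʳ D′ (here refl)))))

record Key (K : Tab ℕ) : Set where
  field
    ascending : All Ascending K
    positive  : All (All (1 ≤_)) K
    nonEmpty  : All (λ C → 1 ≤ length C) K
    nested    : Linked _⊇_ K

nestedCols⇒Linked : ∀ K → T (nestedCols K) → Linked _⊇_ K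
nestedCols⇒Linked [] _ = []
nestedCols⇒Linked (a ∷ []) _ = [-]
nestedCols⇒Linked (a ∷ b ∷ r) h =
  memB⇒∈ a ∘ All.lookup (allB⇒All b (proj₁ (T-∧⁻ h))) ∷ nestedCols⇒Linked (b ∷ r) (proj₂ (T-∧⁻ h))

isKey⇒Key : ∀ K → T (isKey K) → Key K
isKey⇒Key K h = record
  { ascending = All.map (λ {C} t → strictInc⇒Ascending C (proj₁ (T-∧⁻ t))) columns
  ; positive  = All.map (λ {C} t → All.map (≤ᵇ⇒≤ 1 _) (allB⇒All C (proj₂ (T-∧⁻ t)))) columns
  ; nonEmpty  = All.map⁻ {f = length} (All.map (λ {l} → ≤ᵇ⇒≤ 1 l) (allB⇒All (shape K) lengths-positive))
  ; nested    = nestedCols⇒Linked K (proj₂ rest)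
  }
  where
  valid = T-∧⁻ {validShape (shape K)} h
  lengths-positive = proj₁ (T-∧⁻ (proj₁ valid))
  rest = T-∧⁻ (proj₂ valid)
  columns = allB⇒All K (proj₁ rest)

capViews : ∀ n {K} → All Ascending K → All (λ C → length C ≤ n) K → All (CapView n) K
capViews n asc len = All.zipWith (λ (a , l) → capView n a l) (asc , len)

shape-cap : ∀ {n K} → All (CapView n) K → shape (cap n K) ≡ shape K
shape-cap [] = refl
shape-cap (v ∷ vs) = cong₂ _∷_ (length-capCol v) (shape-cap vs)

cap-nested : ∀ {n K} → All (CapView n) K → Linked _⊇_ K → Linked _⊇_ (cap n K)
cap-nested [] [] = []
cap-nested (_ ∷ []) [-] = [-]
cap-nested (v ∷ vs@(w ∷ _)) (a⊇b ∷ l) = capCol-mono v (capView-ascending w) a⊇b ∷ cap-nested vs l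

cap-Key : ∀ {n K} → Key K → All (CapView n) K → Key (cap n K)
cap-Key {n} key views = record
  { ascending = All.map⁺ (All.map (capCol-ascending n ∘ Ascending⇒Unique) ascending)
  ; positive  = All.map⁺ (All.map (capCol-positive n) positive)
  ; nonEmpty  = All.map⁺ (All.zipWith (λ (v , ne) → subst (1 ≤_) (sym (length-capCol v)) ne) (views , nonEmpty))
  ; nested    = cap-nested views nested
  }
  where open Key key

cap-≤ : ∀ n K → All (All (_≤ n)) (cap n K)
cap-≤ n K = All.map⁺ (All.tabulate (λ {C} _ → capCol-≤ n C))

leqTab-cap : ∀ {n X K} → All (λ S → Ascending S × All (_≤ n) S) X → All (CapView n) K →
             leqTab X (cap n K) ≡ leqTab X K
leqTab-cap {X = []} {[]} _ _ = refl
leqTab-cap {X = []} {_ ∷ _} _ _ = refl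
leqTab-cap {X = _ ∷ _} {[]} _ _ = refl
leqTab-cap {X = _ ∷ _} {_ ∷ _} ((S↑ , S≤) ∷ Ss) (v ∷ vs) = cong₂ _∧_ (leqCol-capCol S↑ S≤ v) (leqTab-cap Ss vs)

maxL-≤ : ∀ {n} xs → All (_≤ n) xs → maxL xs ≤ n
maxL-≤ [] _ = z≤n
maxL-≤ (x ∷ xs) (x≤ ∷ xs≤) = ⊔-lub x≤ (maxL-≤ xs xs≤)

minL≤maxL : ∀ xs → T (nonempty xs) → minL xs ≤ maxL xs
minL≤maxL (x ∷ xs) _ = ≤-trans (foldr-⊓≤ xs) (m≤m⊔n x (maxL xs))
  where
  foldr-⊓≤ : ∀ ys → foldr _⊓_ x ys ≤ x
  foldr-⊓≤ [] = ≤-refl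
  foldr-⊓≤ (y ∷ ys) = ≤-trans (m⊓n≤n y _) (foldr-⊓≤ ys)

colOK-maxima : ∀ col → All (T ∘ nonempty) col → T (colOK col) → Linked _>_ (map maxL col)
colOK-maxima [] _ _ = []
colOK-maxima (a ∷ []) _ _ = [-]
colOK-maxima (a ∷ b ∷ r) (ne ∷ nes) h =
  <-≤-trans (<ᵇ⇒< _ _ (proj₁ (T-∧⁻ h))) (minL≤maxL a ne) ∷ colOK-maxima (b ∷ r) nes (proj₂ (T-∧⁻ h))

subsetsOf-⊆ : ∀ xs {s} → s ∈ subsetsOf xs → s ⊆ xs
subsetsOf-⊆ [] (here refl) ()
subsetsOf-⊆ (x ∷ xs) m with ∈-++⁻ (subsetsOf xs) m
... | inj₁ m′ = there ∘ subsetsOf-⊆ xs m′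
... | inj₂ m′ with ∈-map⁻ (x ∷_) m′
...   | _ , m″ , refl = ∷⁺ʳ x (subsetsOf-⊆ xs m″)

vecs-∈ : ∀ {A : Set} k (cs : List A) {v} → v ∈ vecs k cs → All (_∈ cs) v
vecs-∈ zero cs (here refl) = []
vecs-∈ (suc k) cs m with find (∈-concatMap⁻ (λ c → map (c ∷_) (vecs k cs)) {xs = cs} m)
... | c , c∈ , m′ with ∈-map⁻ (c ∷_) m′
...   | _ , m″ , refl = c∈ ∷ vecs-∈ k cs m″

fillings-∈ : ∀ {A : Set} sh (cs : List A) {Q} → Q ∈ fillings sh cs → All (All (_∈ cs)) Q
fillings-∈ [] cs (here refl) = []
fillings-∈ (l ∷ ls) cs m with find (∈-concatMap⁻ (λ col → map (col ∷_) (fillings ls cs)) {xs = vecs l cs} m)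
... | col , col∈ , m′ with ∈-map⁻ (col ∷_) m′
...   | _ , m″ , refl = vecs-∈ l cs col∈ ∷ fillings-∈ ls cs m″

rsvt-columns : ∀ Q → T (isRSVT Q) → All (λ col → All (T ∘ nonempty) col × T (colOK col)) Q
rsvt-columns Q h = All.zipWith (λ (cells , ok) → All.map (proj₁ ∘ T-∧⁻) cells , ok)
                               (All.map (allB⇒All _) (allB⇒All Q (proj₁ rest)) , allB⇒All Q (proj₁ (T-∧⁻ (proj₂ rest))))
  where rest = T-∧⁻ (proj₂ (T-∧⁻ {validShape (shape Q)} h))

Kminus-Lg-bounded : ∀ {n} sh {Q} → Q ∈ fillings sh (nonemptySubsets n) → T (isRSVT Q) →
                    All (λ S → Ascending S × All (_≤ n) S) (Kminus (Lg Q))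
Kminus-Lg-bounded sh {[]} _ _ = []
Kminus-Lg-bounded {n} sh {q ∷ Qs} m h with All.head (rsvt-columns (q ∷ Qs) h)
... | nonempty-cells , colOK-q =
  All.map (λ (S↑ , S⊆) → S↑ , All.tabulate (All.lookup maxima≤ ∘ S⊆)) (Kminus-⊆-head (Lg Qs) maxima-unique)
  where
  maxima-unique : Unique (map maxL q)
  maxima-unique = AllPairs.map >⇒≢ (Linked⇒AllPairs (λ x>y y>z → <-trans y>z x>y) (colOK-maxima q nonempty-cells colOK-q))
  cell≤ : ∀ {c} → c ∈ nonemptySubsets n → maxL c ≤ n
  cell≤ c∈ = maxL-≤ _ (All.tabulate (proj₂ ∘ ∈-range⁻ n ∘ subsetsOf-⊆ (range n) c⊆))
    where c⊆ = proj₁ (∈-filterB⁻ nonempty _ c∈)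
  maxima≤ : All (_≤ n) (map maxL q)
  maxima≤ = All.map⁺ (All.map cell≤ (All.head (fillings-∈ sh _ m)))

rsvtSum-cap : ∀ {n K} sh off → All (CapView n) K → rsvtSum n sh (cap n K) off ≡ rsvtSum n sh K off
rsvtSum-cap {n} {K} sh off views = cong (map (λ Q → (sum (wtRSVT n Q) ∸ off , wtRSVT n Q))) (filterB-cong _ same)
  where
  same : ∀ {Q} → Q ∈ fillings sh (nonemptySubsets n) →
         (isRSVT Q ∧ leqTab (Kminus (Lg Q)) (cap n K)) ≡ (isRSVT Q ∧ leqTab (Kminus (Lg Q)) K)
  same {Q} m with isRSVT Q in eq
  ... | false = refl
  ... | true = leqTab-cap (Kminus-Lg-bounded sh m (from T-≡ eq)) views

-- Indexed from 0: column j K is the paper's T_{j+1}.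
column : ℕ → Tab ℕ → List ℕ
column j [] = []
column zero (C ∷ _) = C
column (suc j) (_ ∷ K) = column j K

-- wtTab n K unfolds to map (λ i → multiplicity i K) (range n).
multiplicity : ℕ → Tab ℕ → ℕ
multiplicity i K = sum (map (countB (_≡ᵇ i)) K)

column-All : ∀ {P : List ℕ → Set} {K} j → All P K → P [] → P (column j K)
column-All j [] p[] = p[]
column-All zero (pC ∷ _) _ = pC
column-All (suc j) (_ ∷ pK) p[] = column-All j pK p[]

column-length : ∀ K → column (length K) K ≡ []
column-length [] = refl
column-length (_ ∷ K) = column-length K

module _ {p : ℕ → Bool} {i : ℕ} (p⇔ : ∀ {y} → T (p y) ⇔ y ≡ i) where

  countB-∉ : ∀ xs → i ∉ xs → countB p xs ≡ 0
  countB-∉ [] _ = refl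
  countB-∉ (x ∷ xs) i∉ =
    trans (cong length (filterB-reject p xs (i∉ ∘ here ∘ sym ∘ to p⇔))) (countB-∉ xs (i∉ ∘ there))

  countB-∈ : ∀ {xs} → Unique xs → i ∈ xs → countB p xs ≡ 1
  countB-∈ {x ∷ xs} (x≢ ∷ _) (here refl) =
    trans (cong length (filterB-accept p xs (from p⇔ refl))) (cong suc (countB-∉ xs (λ m → All.lookup x≢ m refl)))
  countB-∈ {x ∷ xs} (x≢ ∷ u) (there m) =
    trans (cong length (filterB-reject p xs (All.lookup x≢ m ∘ to p⇔))) (countB-∈ u m)

T-≡ᵇ : ∀ {y i} → T (y ≡ᵇ i) ⇔ y ≡ i
T-≡ᵇ {y} {i} = mk⇔ (≡ᵇ⇒≡ y i) (≡⇒≡ᵇ y i)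

T-≡ᵇ-sym : ∀ {y i} → T (i ≡ᵇ y) ⇔ y ≡ i
T-≡ᵇ-sym {y} {i} = mk⇔ (sym ∘ ≡ᵇ⇒≡ i y) (≡⇒≡ᵇ i y ∘ sym)

∉-nested : ∀ {i : ℕ} {a r} → Linked _⊇_ (a ∷ r) → i ∉ a → All (i ∉_) r
∉-nested [-] _ = []
∉-nested (a⊇b ∷ l) i∉a = (i∉a ∘ a⊇b) ∷ ∉-nested l (i∉a ∘ a⊇b)

multiplicity-∈ : ∀ {i a} r → Unique a → i ∈ a → multiplicity i (a ∷ r) ≡ suc (multiplicity i r)
multiplicity-∈ r u i∈ = cong (_+ _) (countB-∈ T-≡ᵇ u i∈)

multiplicity-∉ : ∀ {i} K → All (i ∉_) K → multiplicity i K ≡ 0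
multiplicity-∉ [] [] = refl
multiplicity-∉ (C ∷ K) (i∉ ∷ i∉s) = cong₂ _+_ (countB-∉ T-≡ᵇ C i∉) (multiplicity-∉ K i∉s)

∈-column⇒< : ∀ {i} K j → All Unique K → Linked _⊇_ K → i ∈ column j K → j < multiplicity i K
∈-column⇒< {i} (a ∷ r) j (u ∷ us) l m with i ∈? a
... | no i∉a with j
...   | zero = ⊥-elim (i∉a m)
...   | suc j′ = ⊥-elim (column-All {P = i ∉_} j′ (∉-nested l i∉a) (λ ()) m)
∈-column⇒< {i} (a ∷ r) zero (u ∷ us) l m | yes i∈a rewrite multiplicity-∈ r u i∈a = s≤s z≤n
∈-column⇒< {i} (a ∷ r) (suc j) (u ∷ us) l m | yes i∈a rewrite multiplicity-∈ r u i∈a =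
  s≤s (∈-column⇒< r j us (Linked.tail l) m)

<⇒∈-column : ∀ {i} K j → All Unique K → Linked _⊇_ K → j < multiplicity i K → i ∈ column j K
<⇒∈-column {i} (a ∷ r) j (u ∷ us) l lt with i ∈? a
... | no i∉a = case subst (j <_) (multiplicity-∉ (a ∷ r) (i∉a ∷ ∉-nested l i∉a)) lt of λ ()
... | yes i∈a with j
...   | zero = i∈a
...   | suc j′ = <⇒∈-column r j′ us (Linked.tail l) (s≤s⁻¹ (subst (suc j′ <_) (multiplicity-∈ r u i∈a) lt))

keyCol-countFrom : ∀ c (f : ℕ → ℕ) s k →
                   keyCol c s (map f (countFrom s k)) ≡ filterB (λ i → c ≤ᵇ f i) (countFrom s k)
keyCol-countFrom c f s zero = refl
keyCol-countFrom c f s (suc k) with c ≤ᵇ f s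
... | true = cong (s ∷_) (keyCol-countFrom c f (suc s) k)
... | false = keyCol-countFrom c f (suc s) k

map-countFrom-column : ∀ s K {h : ℕ → List ℕ} → (∀ j → h (s + j) ≡ column j K) → map h (countFrom s (length K)) ≡ K
map-countFrom-column s [] _ = refl
map-countFrom-column s (a ∷ r) {h} eq = cong₂ _∷_ (trans (cong h (sym (+-identityʳ s))) (eq 0))
  (map-countFrom-column (suc s) r (λ j → trans (cong h (sym (+-suc s j))) (eq (suc j))))

≤-maxL : ∀ {x} xs → x ∈ xs → x ≤ maxL xs
≤-maxL (y ∷ ys) (here refl) = m≤m⊔n y (maxL ys)
≤-maxL (y ∷ ys) (there m) = ≤-trans (≤-maxL ys m) (m≤n⊔m y (maxL ys))

last-column-nonempty : ∀ a r → All (λ C → 1 ≤ length C) (a ∷ r) → ∃ (_∈ column (length r) (a ∷ r))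
last-column-nonempty (x ∷ _) [] _ = x , here refl
last-column-nonempty a (b ∷ r) (_ ∷ ne) = last-column-nonempty b r ne

multiplicity≤length : ∀ {i} K → All Unique K → Linked _⊇_ K → multiplicity i K ≤ length K
multiplicity≤length {i} K u l =
  ≮⇒≥ λ lt → case subst (i ∈_) (column-length K) (<⇒∈-column K (length K) u l lt) of λ ()

length≤maxL-wtTab : ∀ {n} K → All Unique K → Linked _⊇_ K → All (λ C → 1 ≤ length C) K →
                    All (All (_∈ range n)) K → length K ≤ maxL (wtTab n K)
length≤maxL-wtTab [] _ _ _ _ = z≤n
length≤maxL-wtTab {n} K@(a ∷ r) u l ne K∈ with last-column-nonempty a r ne
... | z , z∈ = ≤-trans (∈-column⇒< K (length r) u l z∈)
                       (≤-maxL (wtTab n K) (∈-map⁺ _ (All.lookup (column-All (length r) K∈ []) z∈)))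

module _ {n K} (key : Key K) (K∈ : All (All (_∈ range n)) K) where
  open Key key

  private
    unique = All.map Ascending⇒Unique ascending

  maxL-wtTab : maxL (wtTab n K) ≡ length K
  maxL-wtTab = ≤-antisym (maxL-≤ (wtTab n K) (All.map⁺ (All.tabulate (λ _ → multiplicity≤length K unique nested))))
                         (length≤maxL-wtTab {n} K unique nested nonEmpty K∈)

  keyOf-wtTab : keyOf (wtTab n K) ≡ K
  keyOf-wtTab = begin
    map (λ c → keyCol c 1 γ) (range (maxL γ))        ≡⟨ cong (λ m → map (λ c → keyCol c 1 γ) (range m)) maxL-wtTab ⟩
    map (λ c → keyCol c 1 γ) (range (length K))      ≡⟨ cong (map (λ c → keyCol c 1 γ)) (range≡countFrom (length K)) ⟩
    map (λ c → keyCol c 1 γ) (countFrom 1 (length K)) ≡⟨ map-countFrom-column 1 K keyCol≡column ⟩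
    K ∎
    where
    open ≡-Reasoning
    γ = wtTab n K
    mult = λ i → multiplicity i K
    keyCol≡column : ∀ j → keyCol (suc j) 1 γ ≡ column j K
    keyCol≡column j = begin
      keyCol (suc j) 1 (map mult (range n))          ≡⟨ cong (keyCol (suc j) 1 ∘ map mult) (range≡countFrom n) ⟩
      keyCol (suc j) 1 (map mult (countFrom 1 n))    ≡⟨ keyCol-countFrom (suc j) mult 1 n ⟩
      filterB above (countFrom 1 n)                    ≡⟨ ascending-⊆-antisym (filterB-AllPairs above (countFrom-ascending 1 n))
                                                          (column-All j ascending []) filter⊆column column⊆filter ⟩
      column j K ∎
      where
      above = λ i → suc j ≤ᵇ mult i
      filter⊆column : filterB above (countFrom 1 n) ⊆ column j K
      filter⊆column m = <⇒∈-column K j unique nested (≤ᵇ⇒≤ _ _ (proj₂ (∈-filterB⁻ above (countFrom 1 n) m)))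
      column⊆filter : column j K ⊆ filterB above (countFrom 1 n)
      column⊆filter m = ∈-filterB⁺ above (subst (_ ∈_) (range≡countFrom n) (All.lookup (column-All j K∈ []) m))
                                     (≤⇒≤ᵇ (∈-column⇒< K j unique nested m))


sum-map-+ : ∀ {A : Set} (f g : A → ℕ) xs → sum (map (λ x → f x + g x) xs) ≡ sum (map f xs) + sum (map g xs)
sum-map-+ f g [] = refl
sum-map-+ f g (x ∷ xs) = trans (cong (f x + g x +_) (sum-map-+ f g xs)) (interchange (f x) (g x) _ _)

sum-map-zero : ∀ {A : Set} (xs : List A) → sum (map (λ _ → 0) xs) ≡ 0
sum-map-zero [] = refl
sum-map-zero (_ ∷ xs) = sum-map-zero xs

sum-map-swap : ∀ {A B : Set} (f : A → B → ℕ) xs ys →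
               sum (map (λ x → sum (map (f x) ys)) xs) ≡ sum (map (λ y → sum (map (λ x → f x y) xs)) ys)
sum-map-swap f xs [] = sum-map-zero xs
sum-map-swap f xs (y ∷ ys) =
  trans (sum-map-+ (λ x → f x y) _ xs) (cong (sum (map (λ x → f x y) xs) +_) (sum-map-swap f xs ys))

sum-countB : ∀ {A : Set} (p : A → Bool) xs → sum (map (λ x → countB p (x ∷ [])) xs) ≡ countB p xs
sum-countB p [] = refl
sum-countB p (x ∷ xs) = trans (cong (countB p (x ∷ []) +_) (sum-countB p xs)) (sym (countB-∷ p x xs))

countB-≡ᵇ-comm : ∀ x i → countB (_≡ᵇ i) (x ∷ []) ≡ countB (x ≡ᵇ_) (i ∷ [])
countB-≡ᵇ-comm x i with x ≡ᵇ i
... | true = refl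
... | false = refl

sum-countB-≡ᵇ : ∀ {R} → Unique R → ∀ {C} → C ⊆ R → sum (map (λ i → countB (_≡ᵇ i) C) R) ≡ length C
sum-countB-≡ᵇ {R} _ {[]} _ = sum-map-zero R
sum-countB-≡ᵇ {R} u {x ∷ C} C⊆R = begin
  sum (map (λ i → countB (_≡ᵇ i) (x ∷ C)) R)
    ≡⟨ cong sum (map-cong (λ i → countB-∷ (_≡ᵇ i) x C) R) ⟩
  sum (map (λ i → countB (_≡ᵇ i) (x ∷ []) + countB (_≡ᵇ i) C) R)
    ≡⟨ sum-map-+ _ _ R ⟩
  sum (map (λ i → countB (_≡ᵇ i) (x ∷ [])) R) + sum (map (λ i → countB (_≡ᵇ i) C) R)
    ≡⟨ cong₂ _+_ x-once (sum-countB-≡ᵇ u (C⊆R ∘ there)) ⟩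
  suc (length C) ∎
  where
  open ≡-Reasoning
  x-once : sum (map (λ i → countB (_≡ᵇ i) (x ∷ [])) R) ≡ 1
  x-once = trans (cong sum (map-cong (countB-≡ᵇ-comm x) R))
                 (trans (sum-countB (x ≡ᵇ_) R) (countB-∈ T-≡ᵇ-sym u (C⊆R (here refl))))

sum-wtTab : ∀ {n K} → All (All (_∈ range n)) K → sum (wtTab n K) ≡ cells K
sum-wtTab {n} {K} K∈ = begin
  sum (map (λ i → sum (map (countB (_≡ᵇ i)) K)) (range n))   ≡⟨ sum-map-swap (λ i → countB (_≡ᵇ i)) (range n) K ⟩
  sum (map (λ C → sum (map (λ i → countB (_≡ᵇ i) C) (range n))) K) ≡⟨ cong sum (each K K∈) ⟩
  sum (map length K) ∎
  where
  open ≡-Reasoning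
  each : ∀ K → All (All (_∈ range n)) K → map (λ C → sum (map (λ i → countB (_≡ᵇ i) C) (range n))) K ≡ map length K
  each [] [] = refl
  each (C ∷ K) (C∈ ∷ K∈) = cong₂ _∷_ (sum-countB-≡ᵇ (range-unique n) (All.lookup C∈)) (each K K∈)

lascoux-wtTab : ∀ {n K} → Key K → All (All (_≤ n)) K → lascoux n (wtTab n K) ≡ rsvtSum n (shape K) K (cells K)
lascoux-wtTab {n} {K} key K≤ = begin
  rsvtSum n (shape (keyOf γ)) (keyOf γ) (sum γ)
    ≡⟨ cong (λ K′ → rsvtSum n (shape K′) K′ (sum γ)) (keyOf-wtTab {n} key K∈) ⟩
  rsvtSum n (shape K) K (sum γ)
    ≡⟨ cong (rsvtSum n (shape K) K) (sum-wtTab {n} K∈) ⟩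
  rsvtSum n (shape K) K (cells K) ∎
  where
  open ≡-Reasoning
  γ = wtTab n K
  K∈ = All.zipWith (All.zipWith (λ (1≤ , ≤n) → ∈-range⁺ n 1≤ ≤n)) (Key.positive key , K≤)

corollary3p3 : (n : ℕ) → 1 ≤ n → (K : Tab ℕ) → T (isKey K) → T (rowsAtMost n K)
    → lhsSum n K ↭ lascoux n (wtTab n (cap n K))
corollary3p3 n _ K isKey-K rows-K = ↭-reflexive (begin
  rsvtSum n (shape K) K (cells K)          ≡⟨ rsvtSum-cap (shape K) (cells K) views ⟨
  rsvtSum n (shape K) K′ (cells K)         ≡⟨ cong (λ sh → rsvtSum n sh K′ (sum sh)) (shape-cap views) ⟨
  rsvtSum n (shape K′) K′ (cells K′)       ≡⟨ lascoux-wtTab (cap-Key key views) (cap-≤ n K) ⟨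
  lascoux n (wtTab n K′) ∎)
  where
  open ≡-Reasoning
  K′ = cap n K
  key = isKey⇒Key K isKey-K
  views = capViews n (Key.ascending key) (All.map (λ {C} → ≤ᵇ⇒≤ (length C) n) (allB⇒All K rows-K))
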